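{- Let $A\in\mathbb{R}^{m\times n}$, let $c\ge 3$ be an odd integer, let $\ell\ge 1$ be an integer, let $t\in M_{c,\ell}$, and let $q^{(0)} := t\,\mathbf{1}_n$ (the constant map $[n]\to\{t\}$). Let $q^{(1)},\dots,q^{(\ell)}$ be obtained by the rounding procedure described below, i.e. $q^{(i+1)}$ is a rounding of $q^{(i)}$ for $i=0,\dots,\ell-1$. Then for every $i\in\{0,1,\dots,\ell\}$, the map $q^{(i)}$ takes at most $2$ different values.
   Context: For an integer $c\ge2$ and $\ell\in\mathbb{N}_0$, $M_{c,\ell}$ is the set of $x\in[0,1]$ of the form $x=\sum_{k=0}^{\ell} x_k c^{ -k}$ with digits $x_k\in\{0,\dots,c-1\}$ (this expansion of length $\ell$ is unique); for such $x$ and $0\le r\le \ell$ write $\lfloor x\rfloor_r := \sum_{k=0}^{r} x_k c^{ -k}$. For $p:[n]\to[c]$, $\operatorname{disc}(A,p,c) := \max_{d\in[c],\, i\in[m]} \left| \sum_{j \in p^{ -1}(d)} a_{ij} - \frac{1}{c}\sum_{j\in[n]} a_{ij}\right|$, $\operatorname{disc}(A,c):=\min_p \operatorname{disc}(A,p,c)$, and $\operatorname{herdisc}(A,c) := \max_{A_0}\operatorname{disc}(A_0,c)$ over all submatrices $A_0$ of $A$. Rounding procedure: given $q^{(i)}:[n]\to M_{c,s}$ with $s=\ell-i\ge1$, let $t^{(1)},\dots,t^{(\tau)}$ be its distinct values and $\mathcal{J}_k := \{j\in[n] : q^{(i)}(j)=t^{(k)}\}$. For each $k$, let $A_{|\mathcal{J}_k}$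 be the submatrix of $A$ formed by the columns indexed by $\mathcal{J}_k$, choose a $c$-coloring $r_k:\mathcal{J}_k\to[c]$ with $\operatorname{disc}(A_{|\mathcal{J}_k}, r_k, c)\le \operatorname{herdisc}(A_{|\mathcal{J}_k},c)$, write $t^{(k)}=\sum_{h=0}^{s} t^{(k)}_h c^{ -h}$ and let $J^{(k)} := \{j\in\mathcal{J}_k : r_k(j)\in\{1,\dots,t^{(k)}_s\}\}$. Then set $q^{(i+1)}(j) := \lfloor t^{(k)}\rfloor_{s-1} + c^{ -s+1}$ for $j\in J^{(k)}$ and $q^{(i+1)}(j) := \lfloor t^{(k)}\rfloor_{s-1}$ for $j\in \mathcal{J}_k\setminus J^{(k)}$. This gives $q^{(i+1)}:[n]\to M_{c,s-1}$.
   Formalization: The matrix A has entries in ℚ rather than ℝ. -}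

module Defs where

open import Data.Nat as ℕ using (ℕ; zero; suc; _<ᵇ_)
open import Data.Nat.DivMod using (_/_; _%_)
open import Data.Fin using (Fin; zero; suc; toℕ; _≟_)
open import Data.Bool using (Bool; true; false; if_then_else_; _∧_)
open import Data.Integer using (+_)
open import Data.Rational as ℚ using (ℚ; 0ℚ; _+_; _-_; _*_; _⊔_; ∣_∣; _≤_)
open import Data.Product using (Σ; ∃; _×_)
open import Data.Sum using (_⊎_)
open import Relation.Nullary.Decidable using (⌊_⌋)
open import Relation.Binary.PropositionalEquality using (_≡_)

-- real matrices are modelled by rational matrices
Matrix : ℕ → ℕ → Set
Matrix m n = Fin m → Fin n → ℚ

∑ : ∀ {n} → (Fin n → ℚ) → ℚ
∑ {zero} f = 0ℚ
∑ {suc n} f = f zero + ∑ (λ i → f (suc i))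

-- finite maximum over Fin n of nonnegative quantities (empty max = 0)
max : ∀ {n} → (Fin n → ℚ) → ℚ
max {zero} f = 0ℚ
max {suc n} f = f zero ⊔ max (λ i → f (suc i))

-- disc of the submatrix of A with rows R and columns J, under the
-- coloring p (colors Fin c ≅ [c]; only its values on J matter)
disc : ∀ {m n} → Matrix m n → (c : ℕ) → .{{_ : ℕ.NonZero c}} →
       (Fin m → Bool) → (Fin n → Bool) → (Fin n → Fin c) → ℚ
disc {m} {n} A c R J p =
  max λ (d : Fin c) → max λ (i : Fin m) →
    if R i
    then ∣ ∑ (λ j → if J j ∧ ⌊ p j ≟ d ⌋ then A i j else 0ℚ)
           - ((+ 1) ℚ./ c) * ∑ (λ j → if J j then A i j else 0ℚ) ∣
    else 0ℚ

-- x ≤ herdisc(A_{|J}, c), i.e. x ≤ max over submatrices A0 of A_{|J}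
-- (row set R, column set J' ⊆ J) of min over colorings p of disc(A0,p,c)
≤herdisc : ∀ {m n} → Matrix m n → (c : ℕ) → .{{_ : ℕ.NonZero c}} →
           (Fin n → Bool) → ℚ → Set
≤herdisc {m} {n} A c J x =
  Σ (Fin m → Bool) λ R → Σ (Fin n → Bool) λ J' →
    ((j : Fin n) → J' j ≡ true → J j ≡ true) ×
    ((p : Fin n → Fin c) → x ≤ disc A c R J' p)

-- Elements of M_{c,s} are represented by numerators N (value N / c^s, N ≤ c^s).
-- For such N: last digit t_s = N % c, ⌊t⌋_{s-1} has numerator N / c at level s-1.

cls : ∀ {n} → (Fin n → ℕ) → ℕ → Fin n → Bool
cls q v j = ⌊ q j ℕ.≟ v ⌋

IsRounding : ∀ {m n} → Matrix m n → (c : ℕ) → .{{_ : ℕ.NonZero c}} →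
             (Fin n → ℕ) → (Fin n → ℕ) → Set
IsRounding {m} {n} A c q q' =
  Σ (ℕ → Fin n → Fin c) λ r →
    ((v : ℕ) → ≤herdisc A c (cls q v) (disc A c (λ _ → true) (cls q v) (r v))) ×
    ((j : Fin n) → q' j ≡ q j / c ℕ.+ (if toℕ (r (q j) j) <ᵇ q j % c then 1 else 0))

AtMostTwoValues : ∀ {n} → (Fin n → ℕ) → Set
AtMostTwoValues {n} q = ∃ λ a → ∃ λ b → (j : Fin n) → q j ≡ a ⊎ q j ≡ b

{-# OPTIONS --safe #-}
module Submission where

-- One rounding step sends x to x / c or x / c + 1, the latter only when c ∤ x; and (a + 1) / c
-- is either a / c, or a / c + 1 with c ∣ a + 1.  So if all values of q lie in {a, a + 1}, all
-- values of its rounding lie in {a / c, a / c + 1}, and by induction every q⁽ⁱ⁾ takes at most two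
-- (consecutive) values.

open import Defs
open import Data.Nat using (ℕ; _≤_; _<_; _^_; suc; zero; NonZero; _+_; _*_; _<ᵇ_)
open import Data.Nat.Properties using (≤-trans; n≤1+n; +-identityʳ; +-comm; m≤n⇒m<n∨m≡n)
open import Data.Nat.DivMod
open import Data.Nat.Divisibility using (_∣_; n∣m*n)
open import Data.Fin using (Fin; toℕ)
open import Data.Bool using (Bool; true; false; if_then_else_)
open import Data.Product using (∃; _,_; _×_)
open import Data.Sum using (_⊎_; inj₁; inj₂)
open import Relation.Nullary using (¬_)
open import Relation.Binary.PropositionalEquality
  using (_≡_; refl; sym; trans; cong; cong₂; subst; module ≡-Reasoning)

infix 4 _∈[_,1+]
_∈[_,1+] : ℕ → ℕ → Set
x ∈[ a ,1+] = x ≡ a ⊎ x ≡ suc a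

ConsecutiveValues : ∀ {n} → (Fin n → ℕ) → Set
ConsecutiveValues {n} q = ∃ λ a → (j : Fin n) → q j ∈[ a ,1+]

ConsecutiveValues⇒AtMostTwoValues : ∀ {n} {q : Fin n → ℕ} →
                                    ConsecutiveValues q → AtMostTwoValues q
ConsecutiveValues⇒AtMostTwoValues (a , q∈) = a , suc a , q∈

m+bit∈[m,1+] : ∀ m (b : Bool) → m + (if b then 1 else 0) ∈[ m ,1+]
m+bit∈[m,1+] m true  = inj₂ (+-comm m 1)
m+bit∈[m,1+] m false = inj₁ (+-identityʳ m)

module _ (c : ℕ) .{{_ : NonZero c}} where

  [1+m]/c≡m/c⊎[1+m]/c≡1+m/c : ∀ m → suc m / c ≡ m / c ⊎ (suc m / c ≡ suc (m / c) × suc m % c ≡ 0)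
  [1+m]/c≡m/c⊎[1+m]/c≡1+m/c m with m≤n⇒m<n∨m≡n (m%n<n m c)
  ... | inj₁ 1+r<c = inj₁ (begin
    suc m / c                       ≡⟨ /-congˡ (cong suc (m≡m%n+[m/n]*n m c)) ⟩
    (suc (m % c) + m / c * c) / c   ≡⟨ +-distrib-/-∣ʳ (suc (m % c)) (n∣m*n (m / c)) ⟩
    suc (m % c) / c + m / c * c / c ≡⟨ cong₂ _+_ (m<n⇒m/n≡0 1+r<c) (m*n/n≡m (m / c) c) ⟩
    m / c                           ∎)
    where open ≡-Reasoning
  ... | inj₂ 1+r≡c = inj₂ ( trans (/-congˡ 1+m≡[1+m/c]*c) (m*n/n≡m (suc (m / c)) c)
                         , trans (%-congˡ 1+m≡[1+m/c]*c) (m*n%n≡0 (suc (m / c)) c))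
    where
    open ≡-Reasoning
    1+m≡[1+m/c]*c : suc m ≡ suc (m / c) * c
    1+m≡[1+m/c]*c = begin
      suc m                     ≡⟨ cong suc (m≡m%n+[m/n]*n m c) ⟩
      suc (m % c) + m / c * c   ≡⟨ cong (_+ m / c * c) 1+r≡c ⟩
      c + m / c * c             ∎

  rounding : ℕ → ℕ → ℕ
  rounding k x = x / c + (if k <ᵇ x % c then 1 else 0)

  rounding-∈[/,1+] : ∀ {a x} k → x ∈[ a ,1+] → rounding k x ∈[ a / c ,1+]
  rounding-∈[/,1+] {a} k (inj₁ refl) = m+bit∈[m,1+] (a / c) (k <ᵇ a % c)
  rounding-∈[/,1+] {a} k (inj₂ refl) with [1+m]/c≡m/c⊎[1+m]/c≡1+m/c a
  ... | inj₁ [1+a]/c≡a/c =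
    subst (λ y → y + (if k <ᵇ suc a % c then 1 else 0) ∈[ a / c ,1+]) (sym [1+a]/c≡a/c)
          (m+bit∈[m,1+] (a / c) (k <ᵇ suc a % c))
  ... | inj₂ ([1+a]/c≡1+a/c , [1+a]%c≡0) = inj₂ (begin
    suc a / c + (if k <ᵇ suc a % c then 1 else 0) ≡⟨ cong (λ r → suc a / c + (if k <ᵇ r then 1 else 0)) [1+a]%c≡0 ⟩
    suc a / c + 0                                 ≡⟨ +-identityʳ _ ⟩
    suc a / c                                     ≡⟨ [1+a]/c≡1+a/c ⟩
    suc (a / c)                                   ∎)
    where open ≡-Reasoning

  IsRounding⇒ConsecutiveValues : ∀ {m n} {A : Matrix m n} {q q′ : Fin n → ℕ} →
                                 IsRounding A c q q′ → ConsecutiveValues q → ConsecutiveValues q′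
  IsRounding⇒ConsecutiveValues {q = q} (r , _ , q′≡) (a , q∈) =
    a / c , λ j → subst (_∈[ a / c ,1+]) (sym (q′≡ j)) (rounding-∈[/,1+] (toℕ (r (q j) j)) (q∈ j))

  iterated-IsRounding⇒ConsecutiveValues :
    ∀ {m n} {A : Matrix m n} ℓ (q : ℕ → Fin n → ℕ) → ConsecutiveValues (q 0) →
    (∀ i → i < ℓ → IsRounding A c (q i) (q (suc i))) →
    ∀ i → i ≤ ℓ → ConsecutiveValues (q i)
  iterated-IsRounding⇒ConsecutiveValues ℓ q q₀∈ rounds zero    _   = q₀∈
  iterated-IsRounding⇒ConsecutiveValues ℓ q q₀∈ rounds (suc i) i<ℓ =
    IsRounding⇒ConsecutiveValues (rounds i i<ℓ)
      (iterated-IsRounding⇒ConsecutiveValues ℓ q q₀∈ rounds i (≤-trans (n≤1+n i) i<ℓ))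

lemma12 : (m n : ℕ) (A : Matrix m n) (c : ℕ) .{{_ : NonZero c}} →
          ¬ (2 ∣ c) → 3 ≤ c →
          (ℓ : ℕ) → 1 ≤ ℓ → (t : ℕ) → t ≤ c ^ ℓ →
          (q : ℕ → Fin n → ℕ) →
          ((j : Fin n) → q 0 j ≡ t) →
          ((i : ℕ) → i < ℓ → IsRounding A c (q i) (q (suc i))) →
          (i : ℕ) → i ≤ ℓ → AtMostTwoValues (q i)
lemma12 m n A c _ _ ℓ _ t _ q q₀≡t rounds i i≤ℓ =
  ConsecutiveValues⇒AtMostTwoValues
    (iterated-IsRounding⇒ConsecutiveValues c ℓ q (t , λ j → inj₁ (q₀≡t j)) rounds i i≤ℓ)
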